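{- Let $2\le k<\omega$ and $\xi<\varepsilon_0$, and write $\mathbb A$ for $\mathbb A_k$. Then: (1) if $\xi>\omega$ and $i<j<\omega$, then $\mathbb A(\xi-1)\le\mathbb A^{(i)}(\xi)<\mathbb A^{(j)}(\xi)$; (2) $\mathrm{mc}(\xi)\le\mathbb A(\xi-1)<\mathbb A(\xi)$; (3) if $\xi>\omega$, then $\mathbb A(\xi)>2\,\mathrm{mc}(\xi)+2$.
   Context: Ordinals: $\varepsilon_0$ is the least ordinal $\varepsilon$ with $\omega^\varepsilon=\varepsilon$. Every $0<\xi<\varepsilon_0$ has a unique $\omega$-normal form $\xi=\omega^{\alpha}b+\gamma$ with $\alpha<\xi$, $b$ a positive natural number, $\gamma<\omega^\alpha$. $\mathrm{coeffs}(0)=\{0\}$, $\mathrm{coeffs}(\omega^\alpha b+\gamma)=\mathrm{coeffs}(\alpha)\cup\mathrm{coeffs}(\gamma)\cup\{b\}$, $\mathrm{mc}(\xi)=\max\mathrm{coeffs}(\xi)$. Fundamental sequences: $0[n]=1[n]=0$; $(\omega^\alpha b+\gamma)[n]=\omega^\alpha b+\gamma[n]$ if $\gamma>0$; $\omega^{\alpha+1}[n]=\omega^\alpha n$; $(\omega^\alpha(b+1))[n]=\omega^\alpha b+(\omega^\alpha)[n]$ if $b>0$; $(\omega^\alpha)[n]=\omega^{\alpha[n]}$ if $\alpha$ is a limit. For $2\le k<\omega$, $\mathbb A_k:\varepsilon_0\to\mathbb N$: $\mathbb A_k(\xi)=\xi+1$ if $\xi<\omega$; if $\xi\ge\omega$,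 write $\xi=\alpha+b$ with $\alpha$ a limit, $b<\omega$; $\mathbb A_k^{(0)}(\xi)=\mathbb A_k(\xi-1)$ if $b>0$, $=\mathrm{mc}(\xi)$ if $b=0$; $\mathbb A_k^{(i+1)}(\xi)=\mathbb A_k(\alpha[\mathbb A_k^{(i)}(\xi)])$; $\mathbb A_k(\xi)=\mathbb A_k^{(k)}(\xi)$. Convention: when $\xi$ is zero or a limit ordinal, the expression $\mathbb A_k(\xi-1)$ denotes $\mathrm{mc}(\xi)$. -}

module Defs where

open import Data.Nat using (ℕ; zero; suc; _+_; _*_; _∸_; _≤_; _<_; _⊔_)
open import Data.Bool using (Bool; true; false)
open import Relation.Binary.PropositionalEquality using (_≡_; refl)

-- Ordinal notations below ε₀ in Cantor (ω-)normal form.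
-- ω^ a · b ⊕ c  denotes  ω^a·b + c.

infix 30 ω^_·_⊕_
infix 4 _<ₒ_

data Cnf : Set where
  𝟎      : Cnf
  ω^_·_⊕_ : Cnf → ℕ → Cnf → Cnf

data _<ₒ_ : Cnf → Cnf → Set where
  <-zero : ∀ {a b c} → 𝟎 <ₒ ω^ a · b ⊕ c
  <-exp  : ∀ {a b c a' b' c'} → a <ₒ a' → ω^ a · b ⊕ c <ₒ ω^ a' · b' ⊕ c'
  <-coef : ∀ {a b c b' c'} → b < b' → ω^ a · b ⊕ c <ₒ ω^ a · b' ⊕ c'
  <-rest : ∀ {a b c c'} → c <ₒ c' → ω^ a · b ⊕ c <ₒ ω^ a · b ⊕ c'

-- normal forms: ξ = ω^α·b + γ with b ≥ 1 and γ < ω^α  (α < ξ is automatic below ε₀)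
data IsNF : Cnf → Set where
  nf-zero : IsNF 𝟎
  nf-term : ∀ {a b c} → IsNF a → 1 ≤ b → IsNF c → c <ₒ ω^ a · 1 ⊕ 𝟎 →
            IsNF (ω^ a · b ⊕ c)

ω : Cnf
ω = ω^ (ω^ 𝟎 · 1 ⊕ 𝟎) · 1 ⊕ 𝟎

mc : Cnf → ℕ
mc 𝟎 = 0
mc (ω^ a · b ⊕ c) = mc a ⊔ mc c ⊔ b

isSucc : Cnf → Bool
isSucc 𝟎 = false
isSucc (ω^ a · b ⊕ (ω^ x · y ⊕ z)) = isSucc (ω^ x · y ⊕ z)
isSucc (ω^ 𝟎 · b ⊕ 𝟎) = true
isSucc (ω^ (ω^ _ · _ ⊕ _) · b ⊕ 𝟎) = false

limPart : Cnf → Cnf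
limPart 𝟎 = 𝟎
limPart (ω^ 𝟎 · b ⊕ c) = 𝟎
limPart (ω^ (ω^ x · y ⊕ z) · b ⊕ c) = ω^ (ω^ x · y ⊕ z) · b ⊕ limPart c

finPart : Cnf → ℕ
finPart 𝟎 = 0
finPart (ω^ 𝟎 · b ⊕ c) = b
finPart (ω^ (ω^ x · y ⊕ z) · b ⊕ c) = finPart c

addFin : Cnf → ℕ → Cnf
addFin 𝟎 zero = 𝟎
addFin 𝟎 (suc m) = ω^ 𝟎 · suc m ⊕ 𝟎
addFin (ω^ a · b ⊕ c) m = ω^ a · b ⊕ addFin c m

-- predecessor ξ - 1 = α + (b - 1)  (meaningful for successor ξ)
pred : Cnf → Cnf
pred ξ = addFin (limPart ξ) (finPart ξ ∸ 1)

ω^·n : Cnf → ℕ → Cnf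
ω^·n a zero = 𝟎
ω^·n a (suc n) = ω^ a · suc n ⊕ 𝟎

mutual
  _[_] : Cnf → ℕ → Cnf
  𝟎 [ n ] = 𝟎
  (ω^ a · b ⊕ (ω^ x · y ⊕ z)) [ n ] = ω^ a · b ⊕ ((ω^ x · y ⊕ z) [ n ])
  (ω^ a · zero ⊕ 𝟎) [ n ] = 𝟎                       -- not a normal form
  (ω^ a · suc zero ⊕ 𝟎) [ n ] = ωpow[ a , n ]
  (ω^ a · suc (suc b) ⊕ 𝟎) [ n ] = ω^ a · suc b ⊕ ωpow[ a , n ]

  ωpow[_,_] : Cnf → ℕ → Cnf
  ωpow[ a , n ] = ωpowAux (isSucc a) a n

  ωpowAux : Bool → Cnf → ℕ → Cnf
  ωpowAux _ 𝟎 n = 𝟎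
  ωpowAux true (ω^ x · y ⊕ z) n = ω^·n (pred (ω^ x · y ⊕ z)) n
  ωpowAux false (ω^ x · y ⊕ z) n = ω^ ((ω^ x · y ⊕ z) [ n ]) · 1 ⊕ 𝟎

-- The functions 𝔸_k, given by their graphs (the recursion is along
-- the ordinal order, not structural).
--   A k ξ n        :  𝔸_k(ξ) = n
--   Ai k i ξ n     :  𝔸_k^{(i)}(ξ) = n         (for ξ ≥ ω)
--   Apred k ξ n    :  𝔸_k(ξ-1) = n, with the convention that 𝔸_k(ξ-1)
--                     denotes mc(ξ) when ξ is zero or a limit

mutual
  data A (k : ℕ) : Cnf → ℕ → Set where
    A-zero : A k 𝟎 1
    A-fin  : ∀ {b c} → A k (ω^ 𝟎 · b ⊕ c) (suc b)
    A-inf  : ∀ {x y z b c n} → Ai k k (ω^ (ω^ x · y ⊕ z) · b ⊕ c) n →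
             A k (ω^ (ω^ x · y ⊕ z) · b ⊕ c) n

  data Ai (k : ℕ) : ℕ → Cnf → ℕ → Set where
    Ai-zero : ∀ {ξ n} → Apred k ξ n → Ai k 0 ξ n
    Ai-suc  : ∀ {i ξ m n} → Ai k i ξ m → A k (limPart ξ [ m ]) n →
              Ai k (suc i) ξ n

  data Apred (k : ℕ) : Cnf → ℕ → Set where
    Apred-succ : ∀ {ξ n} → isSucc ξ ≡ true → A k (pred ξ) n → Apred k ξ n
    Apred-lim  : ∀ {ξ} → isSucc ξ ≡ false → Apred k ξ (mc ξ)

-- The graphs are functional (so the existential statements below
-- speak about the unique values).

open import Data.Empty using (⊥-elim)
open import Relation.Binary.PropositionalEquality using (trans; sym; cong; subst)
open import Data.Bool.Properties using () renaming (_≟_ to _≟B_)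

true≢false : true ≡ false → ∀ {A : Set} → A
true≢false ()

mutual
  A-func : ∀ {k ξ m n} → A k ξ m → A k ξ n → m ≡ n
  A-func A-zero A-zero = refl
  A-func A-fin A-fin = refl
  A-func (A-inf p) (A-inf q) = Ai-func p q

  Ai-func : ∀ {k i ξ m n} → Ai k i ξ m → Ai k i ξ n → m ≡ n
  Ai-func (Ai-zero p) (Ai-zero q) = Apred-func p q
  Ai-func (Ai-suc p p') (Ai-suc q q') with Ai-func p q
  ... | refl = A-func p' q'

  Apred-func : ∀ {k ξ m n} → Apred k ξ m → Apred k ξ n → m ≡ n
  Apred-func (Apred-succ _ p) (Apred-succ _ q) = A-func p q
  Apred-func (Apred-succ e _) (Apred-lim e') = true≢false (trans (sym e) e')
  Apred-func (Apred-lim e) (Apred-succ e' _) = true≢false (trans (sym e') e)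
  Apred-func (Apred-lim _) (Apred-lim _) = refl

module Submission where

-- By well-founded induction on normal forms, where parts (2) and (3) for smaller ordinals
-- suffice. For infinite ξ with limit part α, each iterate 𝔸^{(i+1)}(ξ) = 𝔸(α[𝔸^{(i)}(ξ)])
-- exceeds the previous one, since n ≤ mc(α[n]) and, inductively, mc ≤ 𝔸(· - 1) < 𝔸 below ξ;
-- this gives (1) and (2). For (3): if ξ is a successor other than ω+1 then ξ-1 > ω and
-- mc ξ ≤ mc(ξ-1) + 1, so (3) at ξ-1 and 𝔸(ξ) ≥ 𝔸(ξ-1) + k suffice. If ξ is a limit, then
-- ξ[n] > ω for n ≥ 2, and (3) at ξ[𝔸^{(1)}(ξ)] gives 𝔸^{(2)}(ξ) > 2𝔸^{(1)}(ξ) + 2 > 2 mc ξ + 2.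

open import Defs
open import Data.Bool using (true; false)
open import Data.Empty using (⊥-elim)
open import Data.Nat using (ℕ; zero; suc; _+_; _*_; _⊔_; _≤_; _<_; z≤n; s≤s)
open import Data.Nat.Induction using (<-wellFounded)
open import Data.Nat.Properties
open import Data.Nat.Tactic.RingSolver using (solve-∀)
open import Data.Product using (_×_; _,_; proj₁; ∃-syntax)
open import Data.Sum using (_⊎_; inj₁; inj₂)
open import Induction.WellFounded using (Acc; acc)
open import Relation.Binary.PropositionalEquality using (_≡_; refl; sym; trans; cong; subst)
open import Relation.Nullary using (¬_)

1ₒ : Cnf
1ₒ = ω^ 𝟎 · 1 ⊕ 𝟎

ω+1 : Cnf
ω+1 = ω^ 1ₒ · 1 ⊕ 1ₒ

<ₒ-trans : ∀ {a b c} → a <ₒ b → b <ₒ c → a <ₒ c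
<ₒ-trans <-zero (<-exp q) = <-zero
<ₒ-trans <-zero (<-coef q) = <-zero
<ₒ-trans <-zero (<-rest q) = <-zero
<ₒ-trans (<-exp p) (<-exp q) = <-exp (<ₒ-trans p q)
<ₒ-trans (<-exp p) (<-coef q) = <-exp p
<ₒ-trans (<-exp p) (<-rest q) = <-exp p
<ₒ-trans (<-coef p) (<-exp q) = <-exp q
<ₒ-trans (<-coef p) (<-coef q) = <-coef (<-trans p q)
<ₒ-trans (<-coef p) (<-rest q) = <-coef p
<ₒ-trans (<-rest p) (<-exp q) = <-exp q
<ₒ-trans (<-rest p) (<-coef q) = <-coef q
<ₒ-trans (<-rest p) (<-rest q) = <-rest (<ₒ-trans p q)

term≮1ₒ : ∀ {x y z} → 1 ≤ y → ¬ (ω^ x · y ⊕ z <ₒ 1ₒ)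
term≮1ₒ _ (<-exp ())
term≮1ₒ (s≤s _) (<-coef (s≤s ()))
term≮1ₒ _ (<-rest ())

-- _<ₒ_ is well-founded only on normal forms: c ↦ ω^0·1 + c maps ω to an infinite descending chain.
_⊏_ : Cnf → Cnf → Set
ζ ⊏ ξ = IsNF ζ × ζ <ₒ ξ

Acc-𝟎 : Acc _⊏_ 𝟎
Acc-𝟎 = acc λ { (_ , ()) }

mutual
  Acc-term : ∀ {a b c} → Acc _⊏_ a → Acc _<_ b → Acc _⊏_ c → Acc _⊏_ (ω^ a · b ⊕ c)
  Acc-term accA accB accC = acc (accessible accA accB accC)
    where
    accessible : ∀ {a b c} → Acc _⊏_ a → Acc _<_ b → Acc _⊏_ c → ∀ {ζ} → ζ ⊏ ω^ a · b ⊕ c → Acc _⊏_ ζ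
    accessible _ _ _ (nf-zero , <-zero) = Acc-𝟎
    accessible (acc ra) _ _ (nf-term nfa _ nfc lt , <-exp p) =
      Acc-term (ra (nfa , p)) (<-wellFounded _) (Acc-below-ω^ (ra (nfa , p)) nfc lt)
    accessible accA (acc rb) _ (nf-term _ _ nfc lt , <-coef p) =
      Acc-term accA (rb p) (Acc-below-ω^ accA nfc lt)
    accessible accA accB (acc rc) (nf-term _ _ nfc _ , <-rest p) =
      Acc-term accA accB (rc (nfc , p))

  Acc-below-ω^ : ∀ {a c} → Acc _⊏_ a → IsNF c → c <ₒ ω^ a · 1 ⊕ 𝟎 → Acc _⊏_ c
  Acc-below-ω^ _ nf-zero _ = Acc-𝟎
  Acc-below-ω^ (acc ra) (nf-term nfa _ nfc lt) (<-exp p) =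
    Acc-term (ra (nfa , p)) (<-wellFounded _) (Acc-below-ω^ (ra (nfa , p)) nfc lt)
  Acc-below-ω^ _ (nf-term _ (s≤s _) _ _) (<-coef (s≤s ()))
  Acc-below-ω^ _ (nf-term _ _ _ _) (<-rest ())

Acc-NF : ∀ {ξ} → IsNF ξ → Acc _⊏_ ξ
Acc-NF nf-zero = Acc-𝟎
Acc-NF (nf-term nfa _ nfc lt) =
  Acc-term (Acc-NF nfa) (<-wellFounded _) (Acc-below-ω^ (Acc-NF nfa) nfc lt)

mc-exp≤ : ∀ a b c → mc a ≤ mc (ω^ a · b ⊕ c)
mc-exp≤ a b c = ≤-trans (m≤m⊔n (mc a) (mc c)) (m≤m⊔n _ b)

mc-rest≤ : ∀ a b c → mc c ≤ mc (ω^ a · b ⊕ c)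
mc-rest≤ a b c = ≤-trans (m≤n⊔m (mc a) (mc c)) (m≤m⊔n _ b)

coef≤mc : ∀ a b c → b ≤ mc (ω^ a · b ⊕ c)
coef≤mc a b c = m≤n⊔m _ b

1≤mc : ∀ {a b c} → IsNF (ω^ a · b ⊕ c) → 1 ≤ mc (ω^ a · b ⊕ c)
1≤mc {a} {b} {c} (nf-term _ 1≤b _ _) = ≤-trans 1≤b (coef≤mc a b c)

1≤mc⇒𝟎<ₒ : ∀ {ξ} → 1 ≤ mc ξ → 𝟎 <ₒ ξ
1≤mc⇒𝟎<ₒ {ω^ _ · _ ⊕ _} _ = <-zero

2≤mc⇒1ₒ<ₒ : ∀ {ξ} → IsNF ξ → 2 ≤ mc ξ → 1ₒ <ₒ ξ
2≤mc⇒1ₒ<ₒ (nf-term {ω^ _ · _ ⊕ _} _ _ _ _) _ = <-exp <-zero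
2≤mc⇒1ₒ<ₒ (nf-term {𝟎} {c = 𝟎} _ _ _ _) h = <-coef h
2≤mc⇒1ₒ<ₒ (nf-term {𝟎} {c = ω^ _ · _ ⊕ _} _ _ (nf-term _ h _ _) lt) _ = ⊥-elim (term≮1ₒ h lt)

pred<ₒ : ∀ {ξ} → isSucc ξ ≡ true → pred ξ <ₒ ξ
pred<ₒ {ω^ 𝟎 · zero ⊕ _} _ = <-zero
pred<ₒ {ω^ 𝟎 · suc zero ⊕ _} _ = <-zero
pred<ₒ {ω^ 𝟎 · suc (suc b) ⊕ _} _ = <-coef ≤-refl
pred<ₒ {ω^ ω^ _ · _ ⊕ _ · _ ⊕ ω^ _ · _ ⊕ _} e = <-rest (pred<ₒ e)

pred-IsNF : ∀ {ξ} → IsNF ξ → isSucc ξ ≡ true → IsNF (pred ξ)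
pred-IsNF (nf-term {𝟎} {zero} _ () _ _) _
pred-IsNF (nf-term {𝟎} {suc zero} _ _ _ _) _ = nf-zero
pred-IsNF (nf-term {𝟎} {suc (suc _)} _ _ _ _) _ = nf-term nf-zero (s≤s z≤n) nf-zero <-zero
pred-IsNF (nf-term {ω^ _ · _ ⊕ _} {c = ω^ _ · _ ⊕ _} nfa h nfc lt) e =
  nf-term nfa h (pred-IsNF nfc e) (<ₒ-trans (pred<ₒ e) lt)

mc≤1+mc-pred : ∀ {ξ} → IsNF ξ → isSucc ξ ≡ true → mc ξ ≤ suc (mc (pred ξ))
mc≤1+mc-pred (nf-term {𝟎} {zero} _ () _ _) _
mc≤1+mc-pred (nf-term {𝟎} {suc zero} {𝟎} _ _ _ _) _ = ≤-refl
mc≤1+mc-pred (nf-term {𝟎} {suc (suc _)} {𝟎} _ _ _ _) _ = ≤-refl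
mc≤1+mc-pred (nf-term {𝟎} {c = ω^ _ · _ ⊕ _} _ _ (nf-term _ h _ _) lt) _ = ⊥-elim (term≮1ₒ h lt)
mc≤1+mc-pred (nf-term {a@(ω^ _ · _ ⊕ _)} {b} {ω^ _ · _ ⊕ _} _ _ nfc _) e =
  ⊔-mono-≤ (⊔-mono-≤ (n≤1+n (mc a)) (mc≤1+mc-pred nfc e)) (n≤1+n b)

ω^·n<ₒ : ∀ {a' a} → a' <ₒ a → ∀ n → ω^·n a' n <ₒ ω^ a · 1 ⊕ 𝟎
ω^·n<ₒ _ zero = <-zero
ω^·n<ₒ a'<a (suc n) = <-exp a'<a

mutual
  ωpow[]<ₒ : ∀ a n → ωpow[ a , n ] <ₒ ω^ a · 1 ⊕ 𝟎
  ωpow[]<ₒ 𝟎 n = <-zero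
  ωpow[]<ₒ a@(ω^ _ · _ ⊕ _) n with isSucc a in e
  ... | true = ω^·n<ₒ (pred<ₒ e) n
  ... | false = <-exp ([]<ₒ e n)

  []<ₒ : ∀ {a b c} → isSucc (ω^ a · b ⊕ c) ≡ false → ∀ n → (ω^ a · b ⊕ c) [ n ] <ₒ ω^ a · b ⊕ c
  []<ₒ {c = ω^ _ · _ ⊕ _} e n = <-rest ([]<ₒ e n)
  []<ₒ {𝟎} {c = 𝟎} ()
  []<ₒ {ω^ _ · _ ⊕ _} {zero} {𝟎} _ n = <-zero
  []<ₒ {a@(ω^ _ · _ ⊕ _)} {suc zero} {𝟎} _ n = ωpow[]<ₒ a n
  []<ₒ {a@(ω^ _ · _ ⊕ _)} {suc (suc b)} {𝟎} _ n = <-coef ≤-refl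

ω^·n-IsNF : ∀ {a} → IsNF a → ∀ n → IsNF (ω^·n a n)
ω^·n-IsNF _ zero = nf-zero
ω^·n-IsNF nfa (suc n) = nf-term nfa (s≤s z≤n) nf-zero <-zero

mutual
  ωpow[]-IsNF : ∀ {a} → IsNF a → ∀ n → IsNF (ωpow[ a , n ])
  ωpow[]-IsNF nf-zero n = nf-zero
  ωpow[]-IsNF {a} nfa@(nf-term _ _ _ _) n with isSucc a in e
  ... | true = ω^·n-IsNF (pred-IsNF nfa e) n
  ... | false = nf-term ([]-IsNF nfa e n) (s≤s z≤n) nf-zero <-zero

  []-IsNF : ∀ {a b c} → IsNF (ω^ a · b ⊕ c) → isSucc (ω^ a · b ⊕ c) ≡ false →
            ∀ n → IsNF ((ω^ a · b ⊕ c) [ n ])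
  []-IsNF {c = ω^ _ · _ ⊕ _} (nf-term nfa h nfc lt) e n =
    nf-term nfa h ([]-IsNF nfc e n) (<ₒ-trans ([]<ₒ e n) lt)
  []-IsNF {𝟎} {c = 𝟎} _ ()
  []-IsNF {ω^ _ · _ ⊕ _} {zero} {𝟎} (nf-term _ () _ _)
  []-IsNF {ω^ _ · _ ⊕ _} {suc zero} {𝟎} (nf-term nfa _ _ _) _ n = ωpow[]-IsNF nfa n
  []-IsNF {a@(ω^ _ · _ ⊕ _)} {suc (suc b)} {𝟎} (nf-term nfa _ _ _) _ n =
    nf-term nfa (s≤s z≤n) (ωpow[]-IsNF nfa n) (ωpow[]<ₒ a n)

n≤mc-ω^·n : ∀ a n → n ≤ mc (ω^·n a n)
n≤mc-ω^·n a zero = z≤n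
n≤mc-ω^·n a (suc n) = coef≤mc a (suc n) 𝟎

mutual
  n≤mc-ωpow[n] : ∀ {x y z} → IsNF (ω^ x · y ⊕ z) → ∀ n → n ≤ mc (ωpow[ ω^ x · y ⊕ z , n ])
  n≤mc-ωpow[n] {x} {y} {z} nfa n with isSucc (ω^ x · y ⊕ z) in e
  ... | true = n≤mc-ω^·n (pred (ω^ x · y ⊕ z)) n
  ... | false = ≤-trans (n≤mc-[n] nfa e n) (mc-exp≤ ((ω^ x · y ⊕ z) [ n ]) 1 𝟎)

  n≤mc-[n] : ∀ {a b c} → IsNF (ω^ a · b ⊕ c) → isSucc (ω^ a · b ⊕ c) ≡ false →
             ∀ n → n ≤ mc ((ω^ a · b ⊕ c) [ n ])
  n≤mc-[n] {a} {b} {c@(ω^ _ · _ ⊕ _)} (nf-term _ _ nfc _) e n =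
    ≤-trans (n≤mc-[n] nfc e n) (mc-rest≤ a b (c [ n ]))
  n≤mc-[n] {𝟎} {c = 𝟎} _ ()
  n≤mc-[n] {ω^ _ · _ ⊕ _} {zero} {𝟎} (nf-term _ () _ _)
  n≤mc-[n] {ω^ _ · _ ⊕ _} {suc zero} {𝟎} (nf-term nfa _ _ _) _ n = n≤mc-ωpow[n] nfa n
  n≤mc-[n] {a@(ω^ _ · _ ⊕ _)} {suc (suc b)} {𝟎} (nf-term nfa _ _ _) _ n =
    ≤-trans (n≤mc-ωpow[n] nfa n) (mc-rest≤ a (suc b) (ωpow[ a , n ]))

limPart-isLimit : ∀ ξ → isSucc (limPart ξ) ≡ false
limPart-isLimit 𝟎 = refl
limPart-isLimit (ω^ 𝟎 · _ ⊕ _) = refl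
limPart-isLimit (ω^ ω^ _ · _ ⊕ _ · _ ⊕ c) with limPart c | limPart-isLimit c
... | 𝟎 | _ = refl
... | ω^ _ · _ ⊕ _ | e = e

limPart<ₒ : ∀ {ξ ζ} → ξ <ₒ ζ → limPart ξ <ₒ ζ
limPart<ₒ {𝟎} lt = lt
limPart<ₒ {ω^ 𝟎 · _ ⊕ _} (<-exp _) = <-zero
limPart<ₒ {ω^ 𝟎 · _ ⊕ _} (<-coef _) = <-zero
limPart<ₒ {ω^ 𝟎 · _ ⊕ _} (<-rest _) = <-zero
limPart<ₒ {ω^ ω^ _ · _ ⊕ _ · _ ⊕ _} (<-exp p) = <-exp p
limPart<ₒ {ω^ ω^ _ · _ ⊕ _ · _ ⊕ _} (<-coef p) = <-coef p
limPart<ₒ {ω^ ω^ _ · _ ⊕ _ · _ ⊕ _} (<-rest p) = <-rest (limPart<ₒ p)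

limPart-IsNF : ∀ {ξ} → IsNF ξ → IsNF (limPart ξ)
limPart-IsNF nf-zero = nf-zero
limPart-IsNF (nf-term {𝟎} _ _ _ _) = nf-zero
limPart-IsNF (nf-term {ω^ _ · _ ⊕ _} nfa h nfc lt) = nf-term nfa h (limPart-IsNF nfc) (limPart<ₒ lt)

limPart-of-limit : ∀ {ξ} → IsNF ξ → isSucc ξ ≡ false → limPart ξ ≡ ξ
limPart-of-limit nf-zero _ = refl
limPart-of-limit (nf-term {𝟎} {c = 𝟎} _ _ _ _) ()
limPart-of-limit (nf-term {𝟎} {c = ω^ _ · _ ⊕ _} _ _ (nf-term _ h _ _) lt) _ = ⊥-elim (term≮1ₒ h lt)
limPart-of-limit (nf-term {a@(ω^ _ · _ ⊕ _)} {b} {𝟎} _ _ _ _) _ = refl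
limPart-of-limit (nf-term {a@(ω^ _ · _ ⊕ _)} {b} {ω^ _ · _ ⊕ _} _ _ nfc _) e =
  cong (ω^ a · b ⊕_) (limPart-of-limit nfc e)

limPart[]<ₒ : ∀ {a b c} n → limPart (ω^ a · b ⊕ c) [ n ] <ₒ ω^ a · b ⊕ c
limPart[]<ₒ {𝟎} n = <-zero
limPart[]<ₒ {ω^ _ · _ ⊕ _} {c = 𝟎} n = []<ₒ refl n
limPart[]<ₒ {ω^ _ · _ ⊕ _} {c = ω^ 𝟎 · _ ⊕ _} n = <ₒ-trans ([]<ₒ refl n) (<-rest <-zero)
limPart[]<ₒ {ω^ _ · _ ⊕ _} {c = ω^ ω^ _ · _ ⊕ _ · _ ⊕ _} n = <-rest (limPart[]<ₒ n)

𝟎<pred⊎≡1ₒ : ∀ {ξ} → IsNF ξ → isSucc ξ ≡ true → 𝟎 <ₒ pred ξ ⊎ ξ ≡ 1ₒ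
𝟎<pred⊎≡1ₒ (nf-term {𝟎} {zero} _ () _ _) _
𝟎<pred⊎≡1ₒ (nf-term {𝟎} {suc zero} {𝟎} _ _ _ _) _ = inj₂ refl
𝟎<pred⊎≡1ₒ (nf-term {𝟎} {suc (suc _)} {𝟎} _ _ _ _) _ = inj₁ <-zero
𝟎<pred⊎≡1ₒ (nf-term {𝟎} {c = ω^ _ · _ ⊕ _} _ _ (nf-term _ h _ _) lt) _ = ⊥-elim (term≮1ₒ h lt)
𝟎<pred⊎≡1ₒ (nf-term {ω^ _ · _ ⊕ _} {c = ω^ _ · _ ⊕ _} _ _ _ _) _ = inj₁ <-zero

ω<pred⊎≡ω+1 : ∀ {ξ} → IsNF ξ → isSucc ξ ≡ true → ω <ₒ ξ → ω <ₒ pred ξ ⊎ ξ ≡ ω+1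
ω<pred⊎≡ω+1 {ω^ 𝟎 · _ ⊕ _} _ _ (<-exp ())
ω<pred⊎≡ω+1 {ω^ ω^ _ · _ ⊕ _ · _ ⊕ ω^ _ · _ ⊕ _} _ _ (<-exp p) = inj₁ (<-exp p)
ω<pred⊎≡ω+1 {ω^ ω^ _ · _ ⊕ _ · _ ⊕ ω^ _ · _ ⊕ _} _ _ (<-coef p) = inj₁ (<-coef p)
ω<pred⊎≡ω+1 {ω^ ω^ _ · _ ⊕ _ · _ ⊕ ω^ _ · _ ⊕ _} (nf-term _ _ nfc _) e (<-rest _)
  with 𝟎<pred⊎≡1ₒ nfc e
... | inj₁ p = inj₁ (<-rest p)
... | inj₂ refl = inj₂ refl

1ₒ≤pred : ∀ {ξ} → IsNF ξ → isSucc ξ ≡ true → 1ₒ <ₒ ξ → pred ξ ≡ 1ₒ ⊎ 1ₒ <ₒ pred ξ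
1ₒ≤pred (nf-term {𝟎} {zero} _ () _ _) _ _
1ₒ≤pred (nf-term {𝟎} {suc zero} {𝟎} _ _ _ _) _ (<-coef (s≤s ()))
1ₒ≤pred (nf-term {𝟎} {suc (suc zero)} {𝟎} _ _ _ _) _ _ = inj₁ refl
1ₒ≤pred (nf-term {𝟎} {suc (suc (suc _))} {𝟎} _ _ _ _) _ _ = inj₂ (<-coef (s≤s (s≤s z≤n)))
1ₒ≤pred (nf-term {𝟎} {c = ω^ _ · _ ⊕ _} _ _ (nf-term _ h _ _) lt) _ _ = ⊥-elim (term≮1ₒ h lt)
1ₒ≤pred (nf-term {ω^ _ · _ ⊕ _} {c = ω^ _ · _ ⊕ _} _ _ _ _) _ _ = inj₂ (<-exp <-zero)

ω<ωpow[n] : ∀ {a} → IsNF a → 1ₒ <ₒ a → ∀ {n} → 2 ≤ n → ω <ₒ ωpow[ a , n ]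
ω<ωpow[n] {a@(ω^ _ · _ ⊕ _)} nfa 1<a {n} 2≤n@(s≤s (s≤s _)) with isSucc a in e
... | true with 1ₒ≤pred nfa e 1<a
...   | inj₁ pred≡1 rewrite pred≡1 = <-coef (s≤s (s≤s z≤n))
...   | inj₂ 1<pred = <-exp 1<pred
ω<ωpow[n] {a@(ω^ _ · _ ⊕ _)} nfa 1<a {n} 2≤n | false =
  <-exp (2≤mc⇒1ₒ<ₒ ([]-IsNF nfa e n) (≤-trans 2≤n (n≤mc-[n] nfa e n)))

ω<[n] : ∀ {a b c} → IsNF (ω^ a · b ⊕ c) → isSucc (ω^ a · b ⊕ c) ≡ false →
        ω <ₒ ω^ a · b ⊕ c → ∀ {n} → 2 ≤ n → ω <ₒ (ω^ a · b ⊕ c) [ n ]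
ω<[n] {c = ω^ _ · _ ⊕ _} _ _ (<-exp p) _ = <-exp p
ω<[n] {c = ω^ _ · _ ⊕ _} _ _ (<-coef p) _ = <-coef p
ω<[n] {c = ω^ _ · _ ⊕ _} (nf-term _ _ nfc _) e (<-rest _) {n} 2≤n =
  <-rest (1≤mc⇒𝟎<ₒ (≤-trans (<⇒≤ 2≤n) (n≤mc-[n] nfc e n)))
ω<[n] {𝟎} {c = 𝟎} _ ()
ω<[n] {ω^ _ · _ ⊕ _} {zero} {𝟎} (nf-term _ () _ _)
ω<[n] {ω^ _ · _ ⊕ _} {suc zero} {𝟎} (nf-term nfa _ _ _) _ (<-exp 1<a) 2≤n = ω<ωpow[n] nfa 1<a 2≤n
ω<[n] {ω^ _ · _ ⊕ _} {suc zero} {𝟎} _ _ (<-coef (s≤s ()))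
ω<[n] {ω^ _ · _ ⊕ _} {suc (suc _)} {𝟎} _ _ (<-exp p) _ = <-exp p
ω<[n] {ω^ _ · _ ⊕ _} {suc (suc zero)} {𝟎} _ _ (<-coef _) (s≤s (s≤s _)) = <-rest <-zero
ω<[n] {ω^ _ · _ ⊕ _} {suc (suc (suc _))} {𝟎} _ _ (<-coef _) _ = <-coef (s≤s (s≤s z≤n))

double+2-mono-≤ : ∀ {m n} → m ≤ n → 2 * m + 2 ≤ 2 * n + 2
double+2-mono-≤ m≤n = +-monoˡ-≤ 2 (*-monoʳ-≤ 2 m≤n)

double+2-suc : ∀ m → 2 * suc m + 2 ≡ (2 * m + 2) + 2
double+2-suc = solve-∀

-- Growth of 𝔸_k

module Growth (k : ℕ) (2≤k : 2 ≤ k) where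

  IteratesIncrease ExceedsPred ExceedsDoubleMc : Cnf → Set
  IteratesIncrease ξ = ω <ₒ ξ → (i j : ℕ) → i < j →
    ∃[ a ] ∃[ p ] ∃[ q ] (Apred k ξ a × Ai k i ξ p × Ai k j ξ q × a ≤ p × p < q)
  ExceedsPred ξ = ∃[ a ] ∃[ b ] (Apred k ξ a × A k ξ b × mc ξ ≤ a × a < b)
  ExceedsDoubleMc ξ = ω <ₒ ξ → ∃[ b ] (A k ξ b × 2 * mc ξ + 2 < b)

  Below : Cnf → Set
  Below ξ = ∀ {ζ} → IsNF ζ → ζ <ₒ ξ → ExceedsPred ζ × ExceedsDoubleMc ζ

  A-exists : ∀ {ζ} → ExceedsPred ζ → ∃[ b ] A k ζ b
  A-exists (_ , b , _ , Ab , _) = b , Ab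

  mc<A : ∀ {ζ b} → ExceedsPred ζ → A k ζ b → mc ζ < b
  mc<A {ζ} (_ , _ , _ , Ab' , mc≤a , a<b') Ab = subst (mc ζ <_) (A-func Ab' Ab) (≤-<-trans mc≤a a<b')

  2mc+2<A : ∀ {ζ b} → ExceedsDoubleMc ζ → ω <ₒ ζ → A k ζ b → 2 * mc ζ + 2 < b
  2mc+2<A {ζ} growth ω<ζ Ab with growth ω<ζ
  ... | _ , Ab' , bound = subst (2 * mc ζ + 2 <_) (A-func Ab' Ab) bound

  A-finite : ∀ n → A k (addFin 𝟎 n) (suc n)
  A-finite zero = A-zero
  A-finite (suc n) = A-fin

  Ai-ω : ∀ i → Ai k i ω (suc i)
  Ai-ω zero = Ai-zero (Apred-lim refl)
  Ai-ω (suc i) = Ai-suc (Ai-ω i) A-fin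

  A-ω : A k ω (suc k)
  A-ω = A-inf (Ai-ω k)

  Apred-exists : ∀ {ξ} → IsNF ξ → Below ξ → ∃[ a ] (Apred k ξ a × mc ξ ≤ a)
  Apred-exists {ξ} nf ih with isSucc ξ in e
  ... | false = mc ξ , Apred-lim e , ≤-refl
  ... | true with ih (pred-IsNF nf e) (pred<ₒ e)
  ...   | (_ , b , _ , Ab , mc≤a , a<b) , _ =
    b , Apred-succ e Ab , ≤-trans (mc≤1+mc-pred nf e) (≤-trans (s≤s mc≤a) a<b)

  module Infinite {x y z b c} (nf : IsNF (ω^ (ω^ x · y ⊕ z) · b ⊕ c))
                  (ih : Below (ω^ (ω^ x · y ⊕ z) · b ⊕ c)) where

    X : Cnf
    X = ω^ (ω^ x · y ⊕ z) · b ⊕ c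

    n≤mc-limPart[n] : ∀ n → n ≤ mc (limPart X [ n ])
    n≤mc-limPart[n] = n≤mc-[n] (limPart-IsNF nf) (limPart-isLimit X)

    ih-limPart[n] : ∀ n → ExceedsPred (limPart X [ n ]) × ExceedsDoubleMc (limPart X [ n ])
    ih-limPart[n] n = ih ([]-IsNF (limPart-IsNF nf) (limPart-isLimit X) n) (limPart[]<ₒ n)

    n<A-limPart[n] : ∀ {n q} → A k (limPart X [ n ]) q → n < q
    n<A-limPart[n] {n} Aq = ≤-<-trans (n≤mc-limPart[n] n) (mc<A (proj₁ (ih-limPart[n] n)) Aq)

    Ai-exists : ∀ i → ∃[ p ] Ai k i X p
    Ai-exists zero with Apred-exists nf ih
    ... | a , Aa , _ = a , Ai-zero Aa
    Ai-exists (suc i) with Ai-exists i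
    ... | p , Aip with A-exists (proj₁ (ih-limPart[n] p))
    ...   | q , Aq = q , Ai-suc Aip Aq

    Apred+i≤Ai : ∀ {a i p} → Apred k X a → Ai k i X p → a + i ≤ p
    Apred+i≤Ai {a} Aa (Ai-zero Ap) = ≤-reflexive (trans (+-identityʳ a) (Apred-func Aa Ap))
    Apred+i≤Ai {a} {suc i} {q} Aa (Ai-suc Aim Aq) =
      subst (_≤ q) (sym (+-suc a i)) (≤-<-trans (Apred+i≤Ai Aa Aim) (n<A-limPart[n] Aq))

    mutual
      Ai-≤-mono : ∀ {i j p q} → i ≤ j → Ai k i X p → Ai k j X q → p ≤ q
      Ai-≤-mono i≤j Aip Ajq with m≤n⇒m<n∨m≡n i≤j
      ... | inj₁ i<j = <⇒≤ (Ai-<-mono i<j Aip Ajq)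
      ... | inj₂ refl = ≤-reflexive (Ai-func Aip Ajq)

      Ai-<-mono : ∀ {i j p q} → i < j → Ai k i X p → Ai k j X q → p < q
      Ai-<-mono (s≤s i≤j) Aip (Ai-suc Ajm Aq) = ≤-<-trans (Ai-≤-mono i≤j Aip Ajm) (n<A-limPart[n] Aq)

    iteratesIncrease : IteratesIncrease X
    iteratesIncrease _ i j i<j with Apred-exists nf ih | Ai-exists i | Ai-exists j
    ... | a , Aa , _ | p , Aip | q , Ajq =
      a , p , q , Aa , Aip , Ajq , ≤-trans (m≤m+n a i) (Apred+i≤Ai Aa Aip) , Ai-<-mono i<j Aip Ajq

    exceedsPred : ExceedsPred X
    exceedsPred with Apred-exists nf ih | Ai-exists k
    ... | a , Aa , mc≤a | q , Akq =
      a , q , Aa , A-inf Akq , mc≤a , <-≤-trans (m<m+n a (<-≤-trans (s≤s z≤n) 2≤k)) (Apred+i≤Ai Aa Akq)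

    2mc+2<Ai-succ : isSucc X ≡ true → ω <ₒ X → ∀ {q} → Ai k k X q → 2 * mc X + 2 < q
    2mc+2<Ai-succ e ω<X {q} Akq with ih (pred-IsNF nf e) (pred<ₒ e)
    ... | (_ , a , _ , Aa , _) , doublePred with Apred+i≤Ai (Apred-succ e Aa) Akq | ω<pred⊎≡ω+1 nf e ω<X
    ...   | a+k≤q | inj₁ ω<pred = begin-strict
      2 * mc X + 2               ≤⟨ double+2-mono-≤ (mc≤1+mc-pred nf e) ⟩
      2 * suc (mc (pred X)) + 2  ≡⟨ double+2-suc (mc (pred X)) ⟩
      (2 * mc (pred X) + 2) + 2  <⟨ +-monoˡ-< 2 (2mc+2<A doublePred ω<pred Aa) ⟩
      a + 2                      ≤⟨ +-monoʳ-≤ a 2≤k ⟩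
      a + k                      ≤⟨ a+k≤q ⟩
      q                          ∎
      where open ≤-Reasoning
    -- 𝔸(ω) = k + 1 and mc(ω+1) = 1.
    ...   | a+k≤q | inj₂ X≡ω+1 =
      subst (λ m → 2 * m + 2 < q) (sym (cong mc X≡ω+1))
        (≤-trans (+-mono-≤ (s≤s 2≤k) 2≤k) (subst (λ a → a + k ≤ q) a≡1+k a+k≤q))
      where
      a≡1+k : a ≡ suc k
      a≡1+k = A-func (subst (λ ζ → A k ζ a) (cong pred X≡ω+1) Aa) A-ω

    2mc+2<Ai-limit : isSucc X ≡ false → ω <ₒ X → ∀ {q} → Ai k k X q → 2 * mc X + 2 < q
    -- The index p = 𝔸^{(1)}(X) is at least 2, which keeps X[p] above ω.
    2mc+2<Ai-limit e ω<X {q} Akq with Ai-exists 1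
    ... | p , A1p with ih-limPart[n] p
    ...   | growth , doubleL with A-exists growth
    ...     | r , Ar = begin-strict
      2 * mc X + 2                   ≤⟨ double+2-mono-≤ (≤-trans (m≤m+n (mc X) 1) mc+1≤p) ⟩
      2 * p + 2                      ≤⟨ double+2-mono-≤ (n≤mc-limPart[n] p) ⟩
      2 * mc (limPart X [ p ]) + 2   <⟨ 2mc+2<A doubleL ω<X[p] Ar ⟩
      r                              ≤⟨ Ai-≤-mono 2≤k (Ai-suc A1p Ar) Akq ⟩
      q                              ∎
      where
      open ≤-Reasoning
      mc+1≤p : mc X + 1 ≤ p
      mc+1≤p = Apred+i≤Ai (Apred-lim e) A1p
      2≤p : 2 ≤ p
      2≤p = ≤-trans (+-monoˡ-≤ 1 (1≤mc nf)) mc+1≤p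
      ω<X[p] : ω <ₒ limPart X [ p ]
      ω<X[p] = subst (λ L → ω <ₒ L [ p ]) (sym (limPart-of-limit nf e)) (ω<[n] nf e ω<X 2≤p)

    exceedsDoubleMc : ExceedsDoubleMc X
    exceedsDoubleMc ω<X with Ai-exists k | isSucc X in e
    ... | q , Akq | true = q , A-inf Akq , 2mc+2<Ai-succ e ω<X Akq
    ... | q , Akq | false = q , A-inf Akq , 2mc+2<Ai-limit e ω<X Akq

  iteratesIncrease : ∀ {ξ} → IsNF ξ → Below ξ → IteratesIncrease ξ
  iteratesIncrease nf-zero _ ()
  iteratesIncrease (nf-term {𝟎} _ _ _ _) _ (<-exp ())
  iteratesIncrease nf@(nf-term {ω^ _ · _ ⊕ _} _ _ _ _) ih = Infinite.iteratesIncrease nf ih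

  exceedsPred : ∀ {ξ} → IsNF ξ → Below ξ → ExceedsPred ξ
  exceedsPred nf-zero _ = 0 , 1 , Apred-lim refl , A-zero , z≤n , s≤s z≤n
  exceedsPred (nf-term {𝟎} {zero} _ () _ _) _
  exceedsPred (nf-term {𝟎} {suc n} {𝟎} _ _ _ _) _ =
    suc n , suc (suc n) , Apred-succ refl (A-finite n) , A-fin , ≤-refl , ≤-refl
  exceedsPred (nf-term {𝟎} {c = ω^ _ · _ ⊕ _} _ _ (nf-term _ h _ _) lt) _ = ⊥-elim (term≮1ₒ h lt)
  exceedsPred nf@(nf-term {ω^ _ · _ ⊕ _} _ _ _ _) ih = Infinite.exceedsPred nf ih

  exceedsDoubleMc : ∀ {ξ} → IsNF ξ → Below ξ → ExceedsDoubleMc ξ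
  exceedsDoubleMc nf-zero _ ()
  exceedsDoubleMc (nf-term {𝟎} _ _ _ _) _ (<-exp ())
  exceedsDoubleMc nf@(nf-term {ω^ _ · _ ⊕ _} _ _ _ _) ih = Infinite.exceedsDoubleMc nf ih

  below : ∀ {ξ} → Acc _⊏_ ξ → Below ξ
  below (acc rs) {ζ} nf lt = exceedsPred nf ih , exceedsDoubleMc nf ih
    where
    ih : Below ζ
    ih = below (rs (nf , lt))

lemma4p3 : (k : ℕ) → 2 ≤ k → (ξ : Cnf) → IsNF ξ →
    ((ω <ₒ ξ → (i j : ℕ) → i < j →
        ∃[ a ] ∃[ p ] ∃[ q ] (Apred k ξ a × Ai k i ξ p × Ai k j ξ q × a ≤ p × p < q))
    × (∃[ a ] ∃[ b ] (Apred k ξ a × A k ξ b × mc ξ ≤ a × a < b))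
    × (ω <ₒ ξ → ∃[ b ] (A k ξ b × 2 * mc ξ + 2 < b)))
lemma4p3 k 2≤k ξ nf = iteratesIncrease nf ih , exceedsPred nf ih , exceedsDoubleMc nf ih
  where
  open Growth k 2≤k
  ih : Below ξ
  ih = below (Acc-NF nf)
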